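{- There are infinitely many triangular numbers which are quotients of tetrahedral numbers; i.e., there are infinitely many positive integers $z$ (giving infinitely many distinct values $t_z$) such that $t_z = \frac{T_y}{T_x}$ for some positive integers $x, y$.
   Context: $t_n = \frac{n(n+1)}{2}$ is the $n$-th triangular number and $T_n = \frac{n(n+1)(n+2)}{6}$ is the $n$-th tetrahedral number. -}

module Defs where

open import Data.Nat using (ℕ; suc; _*_)
open import Data.Nat.DivMod using (_/_)

tri : ℕ → ℕ
tri n = (n * suc n) / 2

tet : ℕ → ℕ
tet n = (n * suc n * suc (suc n)) / 6

module Submission where

-- Since 6 T_y = y (y+1) (y+2) = 2 t_y (y+2), every tetrahedral number
-- satisfies  3 T_y = t_y (y+2).  When y = 3m+1 we have y+2 = 3(m+1), so
-- T_y = t_y (m+1), i.e.  t_y = T_y / (m+1).  Choosing m+1 = T_x itself a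
-- tetrahedral number gives  t_z T_x = T_z  with  z = y = 3 T_x - 2, and
-- since T_x ≥ x these z are unbounded.

open import Defs
open import Data.Nat using (ℕ; zero; suc; _+_; _*_; _<_; _≤_; z≤n; s≤s; NonZero)
open import Data.Nat.Properties using (*-cancelʳ-≡; *-distribʳ-+; m≤m+n; m≤n+m; ≤-trans)
open import Data.Nat.DivMod using (_/_; m*n/n≡m)
open import Data.Nat.Solver using (module +-*-Solver)
open import Data.Product using (_×_; ∃-syntax; _,_)
open import Relation.Binary.PropositionalEquality using (_≡_; refl; sym; trans; cong; cong₂; subst; module ≡-Reasoning)
open +-*-Solver
open ≡-Reasoning

exact-division : ∀ a b d .{{_ : NonZero d}} → a ≡ b * d → a / d ≡ b
exact-division a b d a≡b*d = trans (cong (_/ d) a≡b*d) (m*n/n≡m b d)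

triSum : ℕ → ℕ
triSum zero    = 0
triSum (suc n) = triSum n + suc n

tetSum : ℕ → ℕ
tetSum zero    = 0
tetSum (suc n) = tetSum n + triSum (suc n)

triSum-closed : ∀ n → n * suc n ≡ triSum n * 2
triSum-closed zero    = refl
triSum-closed (suc n) = begin
  suc n * suc (suc n)   ≡⟨ solve 1 (λ n → (con 1 :+ n) :* (con 2 :+ n)
                                         := n :* (con 1 :+ n) :+ (con 1 :+ n) :* con 2) refl n ⟩
  n * suc n + suc n * 2 ≡⟨ cong (_+ suc n * 2) (triSum-closed n) ⟩
  triSum n * 2 + suc n * 2 ≡⟨ sym (*-distribʳ-+ 2 (triSum n) (suc n)) ⟩
  triSum (suc n) * 2    ∎

tetSum-closed : ∀ n → n * suc n * suc (suc n) ≡ tetSum n * 6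
tetSum-closed zero    = refl
tetSum-closed (suc n) = begin
  suc n * suc (suc n) * suc (suc (suc n))
    ≡⟨ solve 1 (λ n → (con 1 :+ n) :* (con 2 :+ n) :* (con 3 :+ n)
                   := n :* (con 1 :+ n) :* (con 2 :+ n) :+ (con 1 :+ n) :* (con 2 :+ n) :* con 3) refl n ⟩
  n * suc n * suc (suc n) + suc n * suc (suc n) * 3
    ≡⟨ cong₂ (λ a b → a + b * 3) (tetSum-closed n) (triSum-closed (suc n)) ⟩
  tetSum n * 6 + triSum (suc n) * 2 * 3
    ≡⟨ solve 2 (λ a b → a :* con 6 :+ b :* con 2 :* con 3 := (a :+ b) :* con 6) refl (tetSum n) (triSum (suc n)) ⟩
  tetSum (suc n) * 6 ∎

tri≡triSum : ∀ n → tri n ≡ triSum n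
tri≡triSum n = exact-division (n * suc n) (triSum n) 2 (triSum-closed n)

tet≡tetSum : ∀ n → tet n ≡ tetSum n
tet≡tetSum n = exact-division (n * suc n * suc (suc n)) (tetSum n) 6 (tetSum-closed n)

-- T_n ≥ n, since T_n ≥ t_n ≥ n; this makes the constructed family unbounded.
n≤tet : ∀ n → n ≤ tet n
n≤tet zero    = z≤n
n≤tet (suc n) = subst (suc n ≤_) (sym (tet≡tetSum (suc n)))
  (≤-trans (m≤n+m (suc n) (triSum n)) (m≤n+m (triSum (suc n)) (tetSum n)))

-- 3 T_n = t_n (n+2): both sides doubled equal n(n+1)(n+2).
tet-via-tri : ∀ n → tet n * 3 ≡ tri n * (2 + n)
tet-via-tri n = *-cancelʳ-≡ (tet n * 3) (tri n * (2 + n)) 2 (begin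
  tet n * 3 * 2               ≡⟨ cong (λ T → T * 3 * 2) (tet≡tetSum n) ⟩
  tetSum n * 3 * 2            ≡⟨ solve 1 (λ T → T :* con 3 :* con 2 := T :* con 6) refl (tetSum n) ⟩
  tetSum n * 6                ≡⟨ sym (tetSum-closed n) ⟩
  n * suc n * suc (suc n)     ≡⟨ cong (_* suc (suc n)) (triSum-closed n) ⟩
  triSum n * 2 * suc (suc n)  ≡⟨ solve 2 (λ t n → t :* con 2 :* (con 2 :+ n) := t :* (con 2 :+ n) :* con 2) refl (triSum n) n ⟩
  triSum n * (2 + n) * 2      ≡⟨ cong (λ t → t * (2 + n) * 2) (sym (tri≡triSum n)) ⟩
  tri n * (2 + n) * 2         ∎)

-- For y = 3m+1 the factor y+2 = 3(m+1), so T_y = t_y (m+1).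
tet-at-3m+1 : ∀ m → tri (1 + 3 * m) * suc m ≡ tet (1 + 3 * m)
tet-at-3m+1 m = *-cancelʳ-≡ (tri y * suc m) (tet y) 3 (begin
  tri y * suc m * 3   ≡⟨ solve 2 (λ t m → t :* (con 1 :+ m) :* con 3 := t :* (con 2 :+ (con 1 :+ con 3 :* m))) refl (tri y) m ⟩
  tri y * (2 + y)     ≡⟨ sym (tet-via-tri y) ⟩
  tet y * 3           ∎)
  where
    y : ℕ
    y = 1 + 3 * m

theorem5p1 : (N : ℕ) → ∃[ z ] (N < z × ∃[ x ] ∃[ y ] (0 < x × 0 < y × tri z * tet x ≡ tet y))
theorem5p1 N = fromTet (tet (suc N)) refl (n≤tet (suc N))
  where
    -- With x = N+1 and T_x = m+1, take z = y = 3m+1; then z > N because m ≥ N.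
    fromTet : ∀ k → tet (suc N) ≡ k → suc N ≤ k →
              ∃[ z ] (N < z × ∃[ x ] ∃[ y ] (0 < x × 0 < y × tri z * tet x ≡ tet y))
    fromTet (suc m) tetx≡m+1 (s≤s N≤m) =
      1 + 3 * m , s≤s (≤-trans N≤m (m≤m+n m (m + (m + 0)))) ,
      suc N , 1 + 3 * m , s≤s z≤n , s≤s z≤n ,
      subst (λ k → tri (1 + 3 * m) * k ≡ tet (1 + 3 * m)) (sym tetx≡m+1) (tet-at-3m+1 m)
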